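{- Let $G$ be a graph and $w$ a vertex of $G$. If $w$ is adjacent to two leaves $v_1$ and $v_2$ (vertices of degree $1$), then $$\phi(G)\le \sum_{u\in N(w)\setminus\{v_1\}}\phi\big(G-(N[w]\cup N[u])\big)+\phi(G-\{w,v_1,v_2\})+\phi(G-N[w]).$$
   Context: All graphs are finite, simple, undirected. A subset of vertices $F$ of a graph $G$ is a dissociation set if the induced subgraph $G[F]$ has maximum degree at most $1$. A maximal dissociation set is a dissociation set that is not a proper subset of any other dissociation set. $\phi(G)$ denotes the number of maximal dissociation sets of $G$ (for the graph with no vertices, $\phi=1$). $N(v)$ is the neighborhood of $v$, $N[v]=N(v)\cup\{v\}$, and for $S\subseteq V(G)$, $G-S$ is the subgraph induced by $V(G)\setminus S$. -}

module Defs where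

open import Data.Nat using (ℕ; zero; suc; _≤_; _+_)
open import Data.Bool using (Bool)
open import Data.Fin using (Fin)
open import Data.Fin.Subset using (Subset; _∈_; _∉_; _⊆_; _⊂_; _∩_; _∪_; ∁; ⁅_⁆; _-_; ∣_∣; ⊤; inside; outside)
open import Data.Fin.Subset.Properties using (_∈?_; anySubset?; _⊂?_)
open import Data.Fin.Properties using (all?)
open import Data.List using (List; []; _∷_; _++_; map; filter; length; allFin)
open import Data.Nat.ListAction using (sum)
open import Data.Vec using (_∷_; []; tabulate)
open import Data.Product using (Σ; _×_; ∃; _,_)
open import Relation.Nullary using (Dec; ¬_; does)
open import Relation.Nullary.Decidable using (_×-dec_; _→-dec_; ¬?)
open import Relation.Binary using (Symmetric; Irreflexive)
open import Relation.Binary.PropositionalEquality using (_≡_)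
open import Data.Nat.Properties using (_≤?_)

record Graph (n : ℕ) : Set₁ where
  field
    Adj   : Fin n → Fin n → Set
    adj?  : (u v : Fin n) → Dec (Adj u v)
    sym   : Symmetric Adj
    irrefl : Irreflexive _≡_ Adj
open Graph public

module _ {n : ℕ} (G : Graph n) where

  N : Fin n → Subset n
  N v = tabulate (λ u → does (adj? G v u))

  N[_] : Fin n → Subset n
  N[ v ] = ⁅ v ⁆ ∪ N v

  degree : Fin n → ℕ
  degree v = ∣ N v ∣

  -- We work with induced subgraphs G[U] for U ⊆ V(G); G - S is G[∁ S].
  -- F is a dissociation set of G[U]: F ⊆ U and every vertex of F has at
  -- most one neighbour in F (i.e. Δ(G[F]) ≤ 1).
  IsDissociation : Subset n → Subset n → Set
  IsDissociation U F = F ⊆ U × (∀ v → v ∈ F → ∣ F ∩ N v ∣ ≤ 1)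

  IsMaximalDissociation : Subset n → Subset n → Set
  IsMaximalDissociation U F =
    IsDissociation U F × ¬ (∃ λ F' → IsDissociation U F' × F ⊂ F')

  isDissociation? : ∀ U F → Dec (IsDissociation U F)
  isDissociation? U F =
    ⊆?' ×-dec all? (λ v → (v ∈? F) →-dec (∣ F ∩ N v ∣ ≤? 1))
    where
    open import Data.Fin.Subset.Properties using (_⊆?_)
    ⊆?' = F ⊆? U

  isMaximalDissociation? : ∀ U F → Dec (IsMaximalDissociation U F)
  isMaximalDissociation? U F =
    isDissociation? U F ×-dec ¬? (anySubset? (λ F' → isDissociation? U F' ×-dec (F ⊂? F')))

subsets : (n : ℕ) → List (Subset n)
subsets zero = [] ∷ []
subsets (suc n) = map (outside ∷_) (subsets n) ++ map (inside ∷_) (subsets n)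

module _ {n : ℕ} (G : Graph n) where

  φ- : Subset n → ℕ
  φ- S = length (filter (isMaximalDissociation? G (∁ S)) (subsets n))

  φ : ℕ
  φ = length (filter (isMaximalDissociation? G ⊤) (subsets n))

ΣOver : {n : ℕ} → Subset n → (Fin n → ℕ) → ℕ
ΣOver {n} A f = sum (map f (filter (_∈? A) (allFin n)))

-- Let F be a maximal dissociation set of G. If w ∉ F, maximality forces both
-- leaves v₁, v₂ into F. If w ∈ F, maximality (try adding v₁) forces w to have a
-- neighbour u in F, and then u is w's only neighbour in F and w is u's. In each
-- case F meets a set T (namely {w, v₁, v₂}, N[w], or N[w] ∪ N[u]) exactly in a
-- pair P (namely {v₁, v₂}, {w, v₁}, or {w, u}) whose neighbourhoods lie in T, and
-- then F ∩ ∁ T is a maximal dissociation set of G − T. Tagging it with the case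
-- (and u) gives an injection from the maximal dissociation sets of G into the
-- disjoint union of those of the graphs on the right-hand side: F is recovered
-- as (F ∩ ∁ T) ∪ P.
module Submission where

open import Defs hiding (sym)
open import Data.Nat using (ℕ; zero; suc; _≤_; _+_; z≤n; s≤s)
open import Data.Nat.Properties using (≤-trans; ≤-reflexive; module ≤-Reasoning)
open import Data.Nat.ListAction using (sum)
open import Data.Fin using (Fin; suc; _≟_)
open import Data.Fin.Properties using (any?)
open import Data.Fin.Subset
  using (Subset; _∈_; _∉_; _⊆_; _⊂_; _∩_; _∪_; ∁; ⁅_⁆; _-_; ∣_∣; ⊤; inside; outside)
open import Data.Fin.Subset.Properties
  using ( _∈?_; ⊆⊤; x∈⁅x⁆; x∈⁅y⁆⇒x≡y; ∣⁅x⁆∣≡1; ∣p∣≤∣x∷p∣; ⊆-antisym; p⊆q⇒∣p∣≤∣q∣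
        ; x∈∁p⇒x∉p; x∉p⇒x∈∁p; x∈p∩q⁺; x∈p∩q⁻; ∣p∩q∣≤∣p∣; p⊆p∪q; q⊆p∪q; x∈p∪q⁻
        ; p∩q⊆p; p∩q⊆q; ∪-comm; x∈p∧x≢y⇒x∈p-y)
open import Data.Vec using ([]; _∷_; tabulate; lookup)
import Data.Vec as Vec
open import Data.Vec.Properties using ([]=⇒lookup; lookup⇒[]=; lookup∘tabulate)
open import Data.List using (List; []; _∷_; _++_; map; concatMap; filter; length; allFin)
open import Data.List.Properties using (length-++; length-map; length-removeAt′; map-cong)
open import Data.List.Membership.Propositional using (_─_; lose)
  renaming (_∈_ to _∈ₗ_)
open import Data.List.Membership.Propositional.Properties
  using (∈-map⁺; ∈-map⁻; ∈-++⁺ˡ; ∈-++⁺ʳ; ∈-filter⁺; ∈-filter⁻; ∈-allFin; ∈-concatMap⁺)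
open import Data.List.Relation.Binary.Subset.Propositional using () renaming (_⊆_ to _⊆ₗ_)
open import Data.List.Relation.Unary.Any using (here; there; index)
import Data.List.Relation.Unary.All as All
open import Data.List.Relation.Unary.AllPairs using ([]; _∷_)
open import Data.List.Relation.Unary.Unique.Propositional using (Unique)
import Data.List.Relation.Unary.Unique.Propositional.Properties as Unique
open import Data.Maybe using (Maybe; just; nothing)
open import Data.Product using (_×_; _,_; ∃; proj₁; proj₂)
open import Data.Sum using (_⊎_; inj₁; inj₂)
open import Data.Empty using (⊥-elim)
open import Relation.Nullary using (yes; no; ¬_; does)
open import Relation.Nullary.Decidable using (dec-true)
open import Relation.Binary.PropositionalEquality
  using (_≡_; _≢_; refl; sym; trans; cong; cong₂; subst; ≢-sym)

module _ {A : Set} where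

  ∈-─ : ∀ {x y} {ys : List A} (x∈ys : x ∈ₗ ys) → y ∈ₗ ys → y ≢ x → y ∈ₗ ys ─ x∈ys
  ∈-─ (here refl) (here refl) y≢x = ⊥-elim (y≢x refl)
  ∈-─ (here refl) (there y∈ys) _  = y∈ys
  ∈-─ (there _)   (here refl) _   = here refl
  ∈-─ (there x∈ys) (there y∈ys) y≢x = there (∈-─ x∈ys y∈ys y≢x)

  Unique∧⊆⇒length≤ : ∀ {xs ys : List A} → Unique xs → xs ⊆ₗ ys → length xs ≤ length ys
  Unique∧⊆⇒length≤ {[]}     _                _     = z≤n
  Unique∧⊆⇒length≤ {x ∷ xs} {ys} (x∉xs ∷ uniq) xs⊆ys =
    subst (suc (length xs) ≤_) (sym (length-removeAt′ ys (index x∈ys)))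
      (s≤s (Unique∧⊆⇒length≤ uniq λ y∈xs →
              ∈-─ x∈ys (xs⊆ys (there y∈xs)) (≢-sym (All.lookup x∉xs y∈xs))))
    where x∈ys = xs⊆ys (here refl)

module _ {A B : Set} where

  length-concatMap : (f : A → List B) (xs : List A) →
                     length (concatMap f xs) ≡ sum (map (λ x → length (f x)) xs)
  length-concatMap f []       = refl
  length-concatMap f (x ∷ xs) =
    trans (length-++ (f x)) (cong (length (f x) +_) (length-concatMap f xs))

∈-subsets : ∀ {n} (p : Subset n) → p ∈ₗ subsets n
∈-subsets []            = here refl
∈-subsets (outside ∷ p) = ∈-++⁺ˡ (∈-map⁺ (outside ∷_) (∈-subsets p))
∈-subsets (inside ∷ p)  = ∈-++⁺ʳ _ (∈-map⁺ (inside ∷_) (∈-subsets p))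

subsets-unique : ∀ n → Unique (subsets n)
subsets-unique zero    = All.[] ∷ []
subsets-unique (suc n) =
  Unique.++⁺ (Unique.map⁺ ∷-injective (subsets-unique n))
             (Unique.map⁺ ∷-injective (subsets-unique n)) disjoint
  where
  ∷-injective : ∀ {s} {p q : Subset n} → _≡_ {A = Subset (suc n)} (s ∷ p) (s ∷ q) → p ≡ q
  ∷-injective refl = refl
  disjoint : ∀ {p} → ¬ (p ∈ₗ map (outside ∷_) (subsets n) × p ∈ₗ map (inside ∷_) (subsets n))
  disjoint (p∈out , p∈in) with ∈-map⁻ (outside ∷_) p∈out | ∈-map⁻ (inside ∷_) p∈in
  ... | _ , _ , refl | _ , _ , ()

module _ {n : ℕ} where

  x∈p⇒1≤∣p∣ : ∀ {p : Subset n} {x} → x ∈ p → 1 ≤ ∣ p ∣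
  x∈p⇒1≤∣p∣ {x = x} x∈p =
    subst (_≤ _) (∣⁅x⁆∣≡1 x) (p⊆q⇒∣p∣≤∣q∣ λ y∈⁅x⁆ → subst (_∈ _) (sym (x∈⁅y⁆⇒x≡y x y∈⁅x⁆)) x∈p)

  p⊆⁅x⁆⇒∣p∣≤1 : ∀ {p : Subset n} x → p ⊆ ⁅ x ⁆ → ∣ p ∣ ≤ 1
  p⊆⁅x⁆⇒∣p∣≤1 x p⊆⁅x⁆ = subst (_ ≤_) (∣⁅x⁆∣≡1 x) (p⊆q⇒∣p∣≤∣q∣ p⊆⁅x⁆)

  x≡y⇒x∈⁅y⁆ : ∀ {x y : Fin n} → x ≡ y → x ∈ ⁅ y ⁆
  x≡y⇒x∈⁅y⁆ {y = y} refl = x∈⁅x⁆ y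

  x∈⁅y⁆∪⁅z⁆⁻ : ∀ {x y z : Fin n} → x ∈ ⁅ y ⁆ ∪ ⁅ z ⁆ → x ≡ y ⊎ x ≡ z
  x∈⁅y⁆∪⁅z⁆⁻ {y = y} {z} x∈ with x∈p∪q⁻ ⁅ y ⁆ ⁅ z ⁆ x∈
  ... | inj₁ x∈⁅y⁆ = inj₁ (x∈⁅y⁆⇒x≡y y x∈⁅y⁆)
  ... | inj₂ x∈⁅z⁆ = inj₂ (x∈⁅y⁆⇒x≡y z x∈⁅z⁆)

  ⁅x⁆∪⁅y⁆⊆p : ∀ {p : Subset n} {x y} → x ∈ p → y ∈ p → ⁅ x ⁆ ∪ ⁅ y ⁆ ⊆ p
  ⁅x⁆∪⁅y⁆⊆p x∈p y∈p z∈ with x∈⁅y⁆∪⁅z⁆⁻ z∈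
  ... | inj₁ refl = x∈p
  ... | inj₂ refl = y∈p

  p∪q∩r⊆p∩r : ∀ {p q r : Subset n} → (∀ {x} → x ∈ q → x ∉ r) → (p ∪ q) ∩ r ⊆ p ∩ r
  p∪q∩r⊆p∩r {p} {q} {r} q∩r≡∅ x∈ with x∈p∩q⁻ (p ∪ q) r x∈
  ... | x∈p∪q , x∈r with x∈p∪q⁻ p q x∈p∪q
  ...   | inj₁ x∈p = x∈p∩q⁺ (x∈p , x∈r)
  ...   | inj₂ x∈q = ⊥-elim (q∩r≡∅ x∈q x∈r)

  p∪q∩r⊆q∩r : ∀ {p q r : Subset n} → (∀ {x} → x ∈ p → x ∉ r) → (p ∪ q) ∩ r ⊆ q ∩ r
  p∪q∩r⊆q∩r {p} {q} {r} p∩r≡∅ x∈ with x∈p∩q⁻ (p ∪ q) r x∈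
  ... | x∈p∪q , x∈r with x∈p∪q⁻ p q x∈p∪q
  ...   | inj₁ x∈p = ⊥-elim (p∩r≡∅ x∈p x∈r)
  ...   | inj₂ x∈q = x∈p∩q⁺ (x∈q , x∈r)

  p⊆q⇒p∩r⊆q∩r : ∀ {p q r : Subset n} → p ⊆ q → p ∩ r ⊆ q ∩ r
  p⊆q⇒p∩r⊆q∩r {p} {r = r} p⊆q x∈ with x∈p , x∈r ← x∈p∩q⁻ p r x∈ = x∈p∩q⁺ (p⊆q x∈p , x∈r)

  p⊆q⇒p∪r⊆q∪r : ∀ {p q r : Subset n} → p ⊆ q → p ∪ r ⊆ q ∪ r
  p⊆q⇒p∪r⊆q∪r {p} {q} {r} p⊆q x∈ with x∈p∪q⁻ p r x∈
  ... | inj₁ x∈p = p⊆p∪q r (p⊆q x∈p)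
  ... | inj₂ x∈r = q⊆p∪q q r x∈r

  p∩∁q∪r≡p : ∀ {p q r : Subset n} → r ⊆ p → p ∩ q ⊆ r → (p ∩ ∁ q) ∪ r ≡ p
  p∩∁q∪r≡p {p} {q} {r} r⊆p p∩q⊆r = ⊆-antisym ⊆p p⊆
    where
    ⊆p : (p ∩ ∁ q) ∪ r ⊆ p
    ⊆p x∈ with x∈p∪q⁻ (p ∩ ∁ q) r x∈
    ... | inj₁ x∈p∩∁q = proj₁ (x∈p∩q⁻ p (∁ q) x∈p∩∁q)
    ... | inj₂ x∈r    = r⊆p x∈r
    p⊆ : p ⊆ (p ∩ ∁ q) ∪ r
    p⊆ {x} x∈p with x ∈? q
    ... | yes x∈q = q⊆p∪q _ r (p∩q⊆r (x∈p∩q⁺ (x∈p , x∈q)))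
    ... | no  x∉q = p⊆p∪q r (x∈p∩q⁺ (x∈p , x∉p⇒x∈∁p x∉q))

∣p∣≤1⇒x≡y : ∀ {n} (p : Subset n) {x y} → ∣ p ∣ ≤ 1 → x ∈ p → y ∈ p → x ≡ y
∣p∣≤1⇒x≡y (inside ∷ p) _ Vec.here Vec.here = refl
∣p∣≤1⇒x≡y (inside ∷ p) (s≤s ∣p∣≤0) Vec.here (Vec.there y∈p)
  with () ← ≤-trans (x∈p⇒1≤∣p∣ y∈p) ∣p∣≤0
∣p∣≤1⇒x≡y (inside ∷ p) (s≤s ∣p∣≤0) (Vec.there x∈p) Vec.here
  with () ← ≤-trans (x∈p⇒1≤∣p∣ x∈p) ∣p∣≤0
∣p∣≤1⇒x≡y (s ∷ p) ∣s∷p∣≤1 (Vec.there x∈p) (Vec.there y∈p) =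
  cong suc (∣p∣≤1⇒x≡y p (≤-trans (∣p∣≤∣x∷p∣ s p) ∣s∷p∣≤1) x∈p y∈p)

module Dissociation {n : ℕ} (G : Graph n) where

  maximals : Subset n → List (Subset n)
  maximals U = filter (isMaximalDissociation? G U) (subsets n)

  maximals-unique : ∀ U → Unique (maximals U)
  maximals-unique U = Unique.filter⁺ (isMaximalDissociation? G U) (subsets-unique n)

  does-adj?≡lookup-N : ∀ v x → does (adj? G v x) ≡ lookup (N G v) x
  does-adj?≡lookup-N v x = sym (lookup∘tabulate (λ u → does (adj? G v u)) x)

  ∈N⇒Adj : ∀ {v x} → x ∈ N G v → Adj G v x
  ∈N⇒Adj {v} {x} x∈Nv with adj? G v x | trans (does-adj?≡lookup-N v x) ([]=⇒lookup x∈Nv)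
  ... | yes v~x | _  = v~x
  ... | no  _   | ()

  Adj⇒∈N : ∀ {v x} → Adj G v x → x ∈ N G v
  Adj⇒∈N {v} {x} v~x =
    lookup⇒[]= x (N G v) (trans (sym (does-adj?≡lookup-N v x)) (dec-true (adj? G v x) v~x))

  N-sym : ∀ {x y} → x ∈ N G y → y ∈ N G x
  N-sym x∈Ny = Adj⇒∈N (Graph.sym G (∈N⇒Adj x∈Ny))

  ∈N[]⁻ : ∀ {v x} → x ∈ N[_] G v → x ≡ v ⊎ x ∈ N G v
  ∈N[]⁻ {v} x∈ with x∈p∪q⁻ ⁅ v ⁆ (N G v) x∈
  ... | inj₁ x∈⁅v⁆ = inj₁ (x∈⁅y⁆⇒x≡y v x∈⁅v⁆)
  ... | inj₂ x∈Nv  = inj₂ x∈Nv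

  N⊆N[] : ∀ v → N G v ⊆ N[_] G v
  N⊆N[] v = q⊆p∪q ⁅ v ⁆ (N G v)

  degree≡1∧Adj⇒∈N⇒≡ : ∀ {v w x} → degree G v ≡ 1 → Adj G v w → x ∈ N G v → x ≡ w
  degree≡1∧Adj⇒∈N⇒≡ {v} deg≡1 v~w x∈Nv = ∣p∣≤1⇒x≡y (N G v) (≤-reflexive deg≡1) x∈Nv (Adj⇒∈N v~w)

  N-pair⊆N[]∪N[] : ∀ {w u a} → a ∈ ⁅ w ⁆ ∪ ⁅ u ⁆ → N G a ⊆ N[_] G w ∪ N[_] G u
  N-pair⊆N[]∪N[] {w} {u} a∈ x∈Na with x∈⁅y⁆∪⁅z⁆⁻ a∈
  ... | inj₁ refl = p⊆p∪q (N[_] G u) (N⊆N[] w x∈Na)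
  ... | inj₂ refl = q⊆p∪q (N[_] G w) (N[_] G u) (N⊆N[] u x∈Na)

  dissociation-⊆ : ∀ {U U′ F P} → IsDissociation G U F → P ⊆ F → P ⊆ U′ → IsDissociation G U′ P
  dissociation-⊆ {F = F} {P} (_ , degF) P⊆F P⊆U′ = P⊆U′ , degP
    where
    degP : ∀ y → y ∈ P → ∣ P ∩ N G y ∣ ≤ 1
    degP y y∈P = ≤-trans (p⊆q⇒∣p∣≤∣q∣ (p⊆q⇒p∩r⊆q∩r {p = P} {q = F} {r = N G y} P⊆F))
                         (degF y (P⊆F y∈P))

  dissociation-∈N-unique : ∀ {U F y x z} → IsDissociation G U F → y ∈ F →
                           x ∈ F ∩ N G y → z ∈ F ∩ N G y → x ≡ z
  dissociation-∈N-unique {F = F} {y} (_ , degF) y∈F = ∣p∣≤1⇒x≡y (F ∩ N G y) (degF y y∈F)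

  dissociation-∪ : ∀ {T F P} → IsDissociation G (∁ T) F → IsDissociation G ⊤ P →
                   (∀ {a} → a ∈ P → N G a ⊆ T) → IsDissociation G ⊤ (F ∪ P)
  dissociation-∪ {T} {F} {P} (F⊆∁T , degF) (_ , degP) NP⊆T = ⊆⊤ , deg
    where
    P↛F : ∀ {y z} → y ∈ F → z ∈ P → z ∉ N G y
    P↛F y∈F z∈P z∈Ny = x∈∁p⇒x∉p (F⊆∁T y∈F) (NP⊆T z∈P (N-sym z∈Ny))
    deg : ∀ y → y ∈ F ∪ P → ∣ (F ∪ P) ∩ N G y ∣ ≤ 1
    deg y y∈F∪P with x∈p∪q⁻ F P y∈F∪P
    ... | inj₁ y∈F = ≤-trans (p⊆q⇒∣p∣≤∣q∣ (p∪q∩r⊆p∩r {p = F} {q = P} {r = N G y} (P↛F y∈F)))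
                             (degF y y∈F)
    ... | inj₂ y∈P = ≤-trans (p⊆q⇒∣p∣≤∣q∣ (p∪q∩r⊆q∩r {p = F} {q = P} {r = N G y}
                                            λ z∈F z∈Ny → P↛F z∈F y∈P (N-sym z∈Ny)))
                             (degP y y∈P)

  maximal-∩∁ : ∀ {T F P} → IsMaximalDissociation G ⊤ F → P ⊆ F → (∀ {a} → a ∈ P → N G a ⊆ T) →
               F ∩ T ⊆ P → IsMaximalDissociation G (∁ T) (F ∩ ∁ T)
  maximal-∩∁ {T} {F} {P} (disF , F-max) P⊆F NP⊆T F∩T⊆P =
    dissociation-⊆ disF (p∩q⊆p F (∁ T)) (p∩q⊆q F (∁ T)) , no-extension
    where
    no-extension : ¬ ∃ λ F′ → IsDissociation G (∁ T) F′ × F ∩ ∁ T ⊂ F′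
    no-extension (F′ , disF′ , F∩∁T⊆F′ , x , x∈F′ , x∉F∩∁T) =
      F-max ( F′ ∪ P
            , dissociation-∪ disF′ (dissociation-⊆ disF P⊆F ⊆⊤) NP⊆T
            , subst (_⊆ F′ ∪ P) (p∩∁q∪r≡p P⊆F F∩T⊆P) (p⊆q⇒p∪r⊆q∪r F∩∁T⊆F′)
            , x , p⊆p∪q P x∈F′ , λ x∈F → x∉F∩∁T (x∈p∩q⁺ (x∈F , proj₁ disF′ x∈F′)))

  leaf∈maximal : ∀ {F v w} → (∀ {x} → x ∈ N G v → x ≡ w) → IsMaximalDissociation G ⊤ F →
                 (w ∈ F → ∀ {x} → x ∈ F → x ∉ N G w) → v ∈ F
  leaf∈maximal {F} {v} {w} Nv≡w ((_ , degF) , F-max) w∈F⇒isolated with v ∈? F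
  ... | yes v∈F = v∈F
  ... | no  v∉F =
    ⊥-elim (F-max (F ∪ ⁅ v ⁆ , (⊆⊤ , deg) , p⊆p∪q ⁅ v ⁆ , v , q⊆p∪q F ⁅ v ⁆ (x∈⁅x⁆ v) , v∉F))
    where
    deg : ∀ y → y ∈ F ∪ ⁅ v ⁆ → ∣ (F ∪ ⁅ v ⁆) ∩ N G y ∣ ≤ 1
    deg y y∈ with x∈p∪q⁻ F ⁅ v ⁆ y∈
    ... | inj₂ y∈⁅v⁆ rewrite x∈⁅y⁆⇒x≡y v y∈⁅v⁆ =
      p⊆⁅x⁆⇒∣p∣≤1 {p = (F ∪ ⁅ v ⁆) ∩ N G v} w λ z∈ → x≡y⇒x∈⁅y⁆ (Nv≡w (p∩q⊆q _ (N G v) z∈))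
    ... | inj₁ y∈F with y ≟ w
    ...   | yes refl = ≤-trans (p⊆q⇒∣p∣≤∣q∣ (p∪q∩r⊆q∩r {p = F} {q = ⁅ v ⁆} {r = N G y}
                                                           (w∈F⇒isolated y∈F)))
                               (subst (∣ ⁅ v ⁆ ∩ N G y ∣ ≤_) (∣⁅x⁆∣≡1 v) (∣p∩q∣≤∣p∣ ⁅ v ⁆ (N G y)))
    ...   | no  y≢w  = ≤-trans (p⊆q⇒∣p∣≤∣q∣ (p∪q∩r⊆p∩r {p = F} {q = ⁅ v ⁆} {r = N G y} v↛y))
                               (degF y y∈F)
      where
      v↛y : ∀ {z} → z ∈ ⁅ v ⁆ → z ∉ N G y
      v↛y z∈⁅v⁆ z∈Ny rewrite x∈⁅y⁆⇒x≡y v z∈⁅v⁆ = y≢w (Nv≡w (N-sym z∈Ny))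

  ∩N[]⊆⁅⁆∪⁅⁆ : ∀ {U F w u} → IsDissociation G U F → w ∈ F → u ∈ F ∩ N G w →
                F ∩ N[_] G w ⊆ ⁅ w ⁆ ∪ ⁅ u ⁆
  ∩N[]⊆⁅⁆∪⁅⁆ {F = F} {w} {u} disF w∈F u∈F∩Nw x∈ with x∈p∩q⁻ F (N[_] G w) x∈
  ... | x∈F , x∈N[w] with ∈N[]⁻ x∈N[w]
  ...   | inj₁ x≡w  = p⊆p∪q ⁅ u ⁆ (x≡y⇒x∈⁅y⁆ x≡w)
  ...   | inj₂ x∈Nw = q⊆p∪q ⁅ w ⁆ ⁅ u ⁆
                        (x≡y⇒x∈⁅y⁆ (dissociation-∈N-unique disF w∈F (x∈p∩q⁺ (x∈F , x∈Nw)) u∈F∩Nw))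

  ∩N[]∪N[]⊆⁅⁆∪⁅⁆ : ∀ {U F w u} → IsDissociation G U F → w ∈ F → u ∈ F ∩ N G w →
                    F ∩ (N[_] G w ∪ N[_] G u) ⊆ ⁅ w ⁆ ∪ ⁅ u ⁆
  ∩N[]∪N[]⊆⁅⁆∪⁅⁆ {F = F} {w} {u} disF w∈F u∈F∩Nw {x} x∈ with x∈p∩q⁻ F _ x∈
  ... | x∈F , x∈N[w]∪N[u] with x∈p∪q⁻ (N[_] G w) (N[_] G u) x∈N[w]∪N[u]
  ...   | inj₁ x∈N[w] = ∩N[]⊆⁅⁆∪⁅⁆ disF w∈F u∈F∩Nw (x∈p∩q⁺ (x∈F , x∈N[w]))
  ...   | inj₂ x∈N[u] = subst (x ∈_) (∪-comm ⁅ u ⁆ ⁅ w ⁆)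
                          (∩N[]⊆⁅⁆∪⁅⁆ disF u∈F w∈F∩Nu (x∈p∩q⁺ (x∈F , x∈N[u])))
    where
    u∈F : u ∈ F
    u∈F = proj₁ (x∈p∩q⁻ F (N G w) u∈F∩Nw)
    w∈F∩Nu : w ∈ F ∩ N G u
    w∈F∩Nu = x∈p∩q⁺ (w∈F , N-sym (proj₂ (x∈p∩q⁻ F (N G w) u∈F∩Nw)))

module TwoLeaves {n : ℕ} (G : Graph n) (w v₁ v₂ : Fin n)
                 (w~v₁ : Adj G w v₁) (w~v₂ : Adj G w v₂)
                 (deg-v₁ : degree G v₁ ≡ 1) (deg-v₂ : degree G v₂ ≡ 1) where

  open Dissociation G

  Code : Set
  Code = Maybe (Fin n) × Subset n

  pair : Maybe (Fin n) → Subset n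
  pair nothing  = ⁅ v₁ ⁆ ∪ ⁅ v₂ ⁆
  pair (just u) = ⁅ w ⁆ ∪ ⁅ u ⁆

  decode : Code → Subset n
  decode (t , S) = S ∪ pair t

  tagged : Maybe (Fin n) → Subset n → List Code
  tagged t T = map (t ,_) (maximals (∁ T))

  length-tagged : ∀ t T → length (tagged t T) ≡ φ- G T
  length-tagged t T = length-map (t ,_) (maximals (∁ T))

  candidates : List (Fin n)
  candidates = filter (_∈? N G w - v₁) (allFin n)

  tagged-candidates : List Code
  tagged-candidates = concatMap (λ u → tagged (just u) (N[_] G w ∪ N[_] G u)) candidates

  codes : List Code
  codes = (tagged-candidates ++ tagged nothing (⁅ w ⁆ ∪ ⁅ v₁ ⁆ ∪ ⁅ v₂ ⁆))
          ++ tagged (just v₁) (N[_] G w)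

  length-codes : length codes ≡ ΣOver (N G w - v₁) (λ u → φ- G (N[_] G w ∪ N[_] G u))
                                + φ- G (⁅ w ⁆ ∪ ⁅ v₁ ⁆ ∪ ⁅ v₂ ⁆) + φ- G (N[_] G w)
  length-codes =
    trans (length-++ (tagged-candidates ++ _))
      (cong₂ _+_ (trans (length-++ tagged-candidates)
                        (cong₂ _+_ length-tagged-candidates (length-tagged _ _)))
                 (length-tagged _ _))
    where
    length-tagged-candidates :
      length tagged-candidates ≡ ΣOver (N G w - v₁) (λ u → φ- G (N[_] G w ∪ N[_] G u))
    length-tagged-candidates =
      trans (length-concatMap _ candidates)
            (cong sum (map-cong (λ u → length-tagged (just u) (N[_] G w ∪ N[_] G u)) candidates))

  encode : ∀ {F} t T → tagged t T ⊆ₗ codes → IsMaximalDissociation G ⊤ F → pair t ⊆ F →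
           (∀ {a} → a ∈ pair t → N G a ⊆ T) → F ∩ T ⊆ pair t → F ∈ₗ map decode codes
  encode t T tagged⊆codes maxF P⊆F NP⊆T F∩T⊆P =
    subst (_∈ₗ map decode codes) (p∩∁q∪r≡p P⊆F F∩T⊆P)
      (∈-map⁺ decode (tagged⊆codes (∈-map⁺ (t ,_)
        (∈-filter⁺ (isMaximalDissociation? G (∁ T)) (∈-subsets _)
                   (maximal-∩∁ maxF P⊆F NP⊆T F∩T⊆P)))))

  v₁-leaf : ∀ {x} → x ∈ N G v₁ → x ≡ w
  v₁-leaf = degree≡1∧Adj⇒∈N⇒≡ deg-v₁ (Graph.sym G w~v₁)

  v₂-leaf : ∀ {x} → x ∈ N G v₂ → x ≡ w
  v₂-leaf = degree≡1∧Adj⇒∈N⇒≡ deg-v₂ (Graph.sym G w~v₂)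

  N-w,v₁⊆N[w] : ∀ {a} → a ∈ ⁅ w ⁆ ∪ ⁅ v₁ ⁆ → N G a ⊆ N[_] G w
  N-w,v₁⊆N[w] a∈ x∈Na with x∈⁅y⁆∪⁅z⁆⁻ a∈
  ... | inj₁ refl = N⊆N[] w x∈Na
  ... | inj₂ refl = p⊆p∪q (N G w) (x≡y⇒x∈⁅y⁆ (v₁-leaf x∈Na))

  w∉maximal⇒decoded : ∀ {F} → IsMaximalDissociation G ⊤ F → w ∉ F → F ∈ₗ map decode codes
  w∉maximal⇒decoded {F} maxF w∉F =
    encode nothing (⁅ w ⁆ ∪ ⁅ v₁ ⁆ ∪ ⁅ v₂ ⁆) (λ c → ∈-++⁺ˡ (∈-++⁺ʳ tagged-candidates c)) maxF
      (⁅x⁆∪⁅y⁆⊆p (leaf∈maximal v₁-leaf maxF w∈F⇒isolated) (leaf∈maximal v₂-leaf maxF w∈F⇒isolated))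
      N-leaves⊆ F∩T⊆leaves
    where
    w∈F⇒isolated : w ∈ F → ∀ {x} → x ∈ F → x ∉ N G w
    w∈F⇒isolated w∈F = ⊥-elim (w∉F w∈F)
    N-leaves⊆ : ∀ {a} → a ∈ ⁅ v₁ ⁆ ∪ ⁅ v₂ ⁆ → N G a ⊆ ⁅ w ⁆ ∪ ⁅ v₁ ⁆ ∪ ⁅ v₂ ⁆
    N-leaves⊆ a∈ x∈Na with x∈⁅y⁆∪⁅z⁆⁻ a∈
    ... | inj₁ refl = p⊆p∪q (⁅ v₁ ⁆ ∪ ⁅ v₂ ⁆) (x≡y⇒x∈⁅y⁆ (v₁-leaf x∈Na))
    ... | inj₂ refl = p⊆p∪q (⁅ v₁ ⁆ ∪ ⁅ v₂ ⁆) (x≡y⇒x∈⁅y⁆ (v₂-leaf x∈Na))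
    F∩T⊆leaves : F ∩ (⁅ w ⁆ ∪ ⁅ v₁ ⁆ ∪ ⁅ v₂ ⁆) ⊆ ⁅ v₁ ⁆ ∪ ⁅ v₂ ⁆
    F∩T⊆leaves x∈ with x∈F , x∈T ← x∈p∩q⁻ F _ x∈ with x∈p∪q⁻ ⁅ w ⁆ _ x∈T
    ... | inj₁ x∈⁅w⁆ = ⊥-elim (w∉F (subst (_∈ F) (x∈⁅y⁆⇒x≡y w x∈⁅w⁆) x∈F))
    ... | inj₂ x∈P   = x∈P

  w∈maximal⇒decoded : ∀ {F} → IsMaximalDissociation G ⊤ F → w ∈ F → F ∈ₗ map decode codes
  w∈maximal⇒decoded {F} maxF w∈F with any? (λ u → u ∈? F ∩ N G w)
  ... | no w-isolated = ⊥-elim (w-isolated (v₁ , x∈p∩q⁺ (v₁∈F , Adj⇒∈N w~v₁)))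
    where
    v₁∈F : v₁ ∈ F
    v₁∈F = leaf∈maximal v₁-leaf maxF λ _ x∈F x∈Nw → w-isolated (_ , x∈p∩q⁺ (x∈F , x∈Nw))
  ... | yes (u , u∈F∩Nw) with u ≟ v₁ | x∈p∩q⁻ F (N G w) u∈F∩Nw
  ...   | yes refl | u∈F , _ =
    encode (just v₁) (N[_] G w) (∈-++⁺ʳ _) maxF (⁅x⁆∪⁅y⁆⊆p w∈F u∈F)
      N-w,v₁⊆N[w] (∩N[]⊆⁅⁆∪⁅⁆ (proj₁ maxF) w∈F u∈F∩Nw)
  ...   | no  u≢v₁ | u∈F , u∈Nw =
    encode (just u) (N[_] G w ∪ N[_] G u) tagged-u⊆codes maxF (⁅x⁆∪⁅y⁆⊆p w∈F u∈F)
      N-pair⊆N[]∪N[] (∩N[]∪N[]⊆⁅⁆∪⁅⁆ (proj₁ maxF) w∈F u∈F∩Nw)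
    where
    u∈candidates : u ∈ₗ candidates
    u∈candidates = ∈-filter⁺ (_∈? N G w - v₁) (∈-allFin u) (x∈p∧x≢y⇒x∈p-y u∈Nw u≢v₁)
    tagged-u⊆codes : tagged (just u) (N[_] G w ∪ N[_] G u) ⊆ₗ codes
    tagged-u⊆codes c = ∈-++⁺ˡ (∈-++⁺ˡ (∈-concatMap⁺ _ (lose u∈candidates c)))

  maximals⊆decoded : maximals ⊤ ⊆ₗ map decode codes
  maximals⊆decoded {F} F∈
    with maxF ← proj₂ (∈-filter⁻ (isMaximalDissociation? G ⊤) {xs = subsets n} F∈)
    with w ∈? F
  ... | yes w∈F = w∈maximal⇒decoded maxF w∈F
  ... | no  w∉F = w∉maximal⇒decoded maxF w∉F

lemma2p4 : {n : ℕ} (G : Graph n) (w v₁ v₂ : Fin n) →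
           v₁ ≢ v₂ → Adj G w v₁ → Adj G w v₂ →
           degree G v₁ ≡ 1 → degree G v₂ ≡ 1 →
           φ G ≤ ΣOver (N G w - v₁) (λ u → φ- G (N[_] G w ∪ N[_] G u))
                 + φ- G (⁅ w ⁆ ∪ ⁅ v₁ ⁆ ∪ ⁅ v₂ ⁆)
                 + φ- G (N[_] G w)
lemma2p4 G w v₁ v₂ _ w~v₁ w~v₂ deg-v₁ deg-v₂ = begin
  φ G                        ≤⟨ Unique∧⊆⇒length≤ (maximals-unique ⊤) maximals⊆decoded ⟩
  length (map decode codes)  ≡⟨ length-map decode codes ⟩
  length codes               ≡⟨ length-codes ⟩
  _                          ∎
  where
  open Dissociation G
  open TwoLeaves G w v₁ v₂ w~v₁ w~v₂ deg-v₁ deg-v₂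
  open ≤-Reasoning
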